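{- Let $k>1$ be an integer, let $G=(V_1,\dots,V_k,E_1,\dots,E_{k-1})$ be a $k$-partite graph with $|V_i|=n$ for all $i$, where $E_i$ is the set of edges between $V_i$ and $V_{i+1}$, and let $m$ be an integer with $m>nk$. Construct the instance $\mathcal{I}(k)$ of $Q|\mathrm{prec}|C_{\max}$ as follows: for each $1\le i\le k$ and each $v\in V_i$, let $\mathcal{J}_{v,i}$ be a set of $m^{2(k-i)}$ jobs each of processing time $m^{i-1}$; for each edge $(v,w)\in E_i$ with $v\in V_i$, $w\in V_{i+1}$ ($1\le i<k$), every job of $\mathcal{J}_{v,i}$ precedes every job of $\mathcal{J}_{w,i+1}$; for each $1\le i\le k$, create a set $\mathcal{M}_i$ of $m^{2(k-i)}$ machines, each of speed $m^{i-1}$. For $1\le i\le k$ let $\mathcal{L}_i=\bigcup_{v\in V_i}\mathcal{J}_{v,i}$. Then in any feasible schedule for $\mathcal{I}(k)$ with makespan at most $nk$, for every $1\le i\le k$, at least a $(1-k^2/m)$ fraction of the jobs in $\mathcal{L}_i$ are scheduled on machines in $\mathcal{M}_i$.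
   Context: $Q|\mathrm{prec}|C_{\max}$: jobs with processing times $p_j$ and precedence constraints (if $J\prec J'$ then $J'$ cannot start before $J$ completes) are to be scheduled non-preemptively on machines with speeds, each job entirely on one machine; job $j$ on a machine of speed $s$ takes time $p_j/s$, and each machine processes at most one job at a time. The makespan is the maximum completion time.
   Formalization: Only feasible schedules whose job start times are rational are considered. -}

module Defs where

open import Data.Nat as ℕ using (ℕ; suc; _*_; _∸_; _^_; NonZero)
open import Data.Nat.Properties using (m^n≢0)
open import Data.Integer using (+_)
open import Data.Fin using (Fin; toℕ; _≟_)
open import Data.Product using (Σ; _×_; _,_; proj₁; proj₂)
open import Data.List using (List; length; filter; cartesianProduct; allFin)
open import Data.Rational using (ℚ; _/_; _+_; _≤_; 0ℚ)
open import Relation.Binary.PropositionalEquality using (_≡_)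
open import Relation.Nullary using (¬_)
open import Data.Sum using (_⊎_)

-- Conventions: layers are 0-based, layer i : Fin k corresponds to the
-- paper's layer i+1.  V_{i+1} = Fin n.  Edge relations E_1..E_{k-1}
-- are given as  E : Fin (k ∸ 1) → Fin n → Fin n → Set , where
-- E e v w  means  (v,w) ∈ E_{e+1}, v in layer e, w in layer e+1.

-- number of jobs per vertex of layer i (0-based), = number of machines
-- of layer i:  m^(2(k-i))  in the paper's 1-based indexing
layerSize : (k m : ℕ) → Fin k → ℕ
layerSize k m i = m ^ (2 * (k ∸ 1 ∸ toℕ i))

Job : (k n m : ℕ) → Set
Job k n m = Σ (Fin k) λ i → Fin n × Fin (layerSize k m i)

jobLayer : ∀ {k n m} → Job k n m → Fin k
jobLayer = proj₁

jobVertex : ∀ {k n m} → Job k n m → Fin n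
jobVertex j = proj₁ (proj₂ j)

Machine : (k m : ℕ) → Set
Machine k m = Σ (Fin k) λ i → Fin (layerSize k m i)

procTime : ∀ {k n} (m : ℕ) → Job k n m → ℕ
procTime m j = m ^ toℕ (proj₁ j)

speed : ∀ {k} (m : ℕ) → Machine k m → ℕ
speed m M = m ^ toℕ (proj₁ M)

runTime : ∀ {k n} (m : ℕ) .{{_ : NonZero m}} → Job k n m → Machine k m → ℚ
runTime m j M = (+ procTime m j) / speed m M
  where instance _ = m^n≢0 m (toℕ (proj₁ M))

Prec : ∀ {k n m} (E : Fin (k ∸ 1) → Fin n → Fin n → Set) →
       Job k n m → Job k n m → Set
Prec {k} E j j' =
  Σ (Fin (k ∸ 1)) λ e →
    (toℕ e ≡ toℕ (jobLayer j)) × (toℕ (jobLayer j') ≡ suc (toℕ e))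
    × E e (jobVertex j) (jobVertex j')

record Schedule (k n m : ℕ) : Set where
  field
    assign : Job k n m → Machine k m
    start  : Job k n m → ℚ

module _ {k n m : ℕ} .{{_ : NonZero m}} where

  completion : Schedule k n m → Job k n m → ℚ
  completion σ j = Schedule.start σ j + runTime m j (Schedule.assign σ j)

  record Feasible (E : Fin (k ∸ 1) → Fin n → Fin n → Set)
                  (σ : Schedule k n m) : Set where
    field
      startNonneg : ∀ j → 0ℚ ≤ Schedule.start σ j
      noOverlap   : ∀ j j' → ¬ (j ≡ j') →
                    Schedule.assign σ j ≡ Schedule.assign σ j' →
                    (completion σ j ≤ Schedule.start σ j')
                    ⊎ (completion σ j' ≤ Schedule.start σ j)
      precedence  : ∀ j j' → Prec E j j' →
                    completion σ j ≤ Schedule.start σ j'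

  MakespanAtMost : Schedule k n m → ℚ → Set
  MakespanAtMost σ C = ∀ j → completion σ j ≤ C

sizeL : (k n m : ℕ) → Fin k → ℕ
sizeL k n m i = n * layerSize k m i

onOwnLayer : ∀ {k n m} → Schedule k n m → Fin k → ℕ
onOwnLayer {k} {n} {m} σ i =
  length (filter (λ p → proj₁ (Schedule.assign σ (i , proj₁ p , proj₂ p)) ≟ i)
                 (cartesianProduct (allFin n) (allFin (layerSize k m i))))

-- A job of layer i has processing time m^(i-1); on a machine of layer j < i it would run for
-- at least m > nk time units, so every job of L_i runs on some layer j ≥ i, where it takes exactly
-- 1/m^(j-i). Scaling time by m^(j-i), two jobs of L_i sharing a machine start in distinct
-- integer slots ⌊start · m^(j-i)⌋ < nk · m^(j-i). Hence the jobs of L_i on a layer j > i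
-- number at most |M_j| · nk · m^(j-i) = nk · m^(2(k-j)+(j-i)) ≤ nk · m^(2(k-i)-1), and over
-- the fewer than k such layers at most k · nk · m^(2(k-i)-1) = (k²/m) |L_i|.
module Submission where

open import Defs
open import Data.Nat using (ℕ; _*_; _>_; _∸_; NonZero)
open import Data.Integer using (+_)
open import Data.Fin using (Fin)
open import Data.Rational using (ℚ; _/_; _-_; _≤_; 1ℚ)
open import Data.Rational using () renaming (_*_ to _*ℚ_)

open import Data.Nat as ℕ using (suc; _+_; _^_; z≤n)
import Data.Nat.Properties as ℕP
open import Algebra.Properties.CommutativeSemigroup ℕP.*-commutativeSemigroup using (x∙yz≈y∙xz; x∙yz≈xz∙y; xy∙z≈xz∙y)
open import Data.Nat.DivMod using (m/n*n≤m; m*n/n≡m; n/1≡n; /-monoˡ-≤; +-distrib-/-∣ˡ; m<n⇒m/n≡0)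
  renaming (_/_ to _div_)
open import Data.Nat.Divisibility using (n∣m*n)
open import Data.Nat.Tactic.RingSolver using (solve-∀)
import Data.Integer as ℤ
import Data.Integer.Properties as ℤP
import Data.Integer.Tactic.RingSolver as ℤSolver
open import Data.Rational as ℚ using (mkℚ; ↥_; ↧ₙ_; 0ℚ; toℚᵘ)
import Data.Rational.Properties as ℚP
import Data.Rational.Unnormalised as U
import Data.Rational.Unnormalised.Properties as UP
open import Data.Fin as Fin using (toℕ; fromℕ<)
import Data.Fin.Properties as FinP
open import Data.Product using (Σ; _×_; _,_; proj₁; proj₂)
open import Data.Product.Properties using (≡-dec)
open import Data.List using (List; []; _∷_; length; map; filter; lookup; cartesianProduct; allFin)
import Data.List.Properties as ListP
open import Data.List.Relation.Unary.All as All using (All; []; _∷_)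
open import Data.List.Relation.Unary.All.Properties using (all-filter)
open import Data.List.Relation.Unary.AllPairs using (_∷_)
open import Data.List.Relation.Unary.Unique.Propositional using (Unique)
import Data.List.Relation.Unary.Unique.Propositional.Properties as UniqueP
open import Data.List.Membership.Propositional.Properties using (∈-lookup)
open import Data.Sum using ([_,_]′)
open import Relation.Binary.PropositionalEquality
open import Relation.Nullary using (¬_; yes; no; contradiction)
open import Relation.Nullary.Decidable using (decidable-stable)
open import Relation.Unary using (Decidable)
open import Relation.Unary.Properties using (∁?)

↥ₙ_ : ℚ → ℕ
↥ₙ s = ℤ.∣ ↥ s ∣

toℚᵘ-nonNeg : ∀ s → 0ℚ ≤ s → toℚᵘ s ≡ U.mkℚᵘ (+ ↥ₙ s) (ℚ.denominator-1 s)
toℚᵘ-nonNeg (mkℚ (+ _) _ _) _ = refl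
toℚᵘ-nonNeg (mkℚ ℤ.-[1+ _ ] _ _) (ℚ.*≤* ())

toℚᵘ-/ : ∀ p d → toℚᵘ (p / suc d) U.≃ U.mkℚᵘ p d
toℚᵘ-/ p d = ℚP.toℚᵘ-fromℚᵘ (U.mkℚᵘ p d)

mkℚᵘ-+-≤⇒ℕ : ∀ a b p q c d →
             U.mkℚᵘ (+ a) b U.+ U.mkℚᵘ (+ p) q U.≤ U.mkℚᵘ (+ c) d →
             (a * suc q + p * suc b) * suc d ℕ.≤ c * (suc b * suc q)
mkℚᵘ-+-≤⇒ℕ a b p q c d (U.*≤* h) = ℤP.drop‿+≤+ (subst₂ ℤ._≤_ lhs (sym (ℤP.pos-* c _)) h)
  where
  open ≡-Reasoning
  lhs : (+ a ℤ.* + suc q ℤ.+ + p ℤ.* + suc b) ℤ.* + suc d ≡ + ((a * suc q + p * suc b) * suc d)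
  lhs = begin
    (+ a ℤ.* + suc q ℤ.+ + p ℤ.* + suc b) ℤ.* + suc d
      ≡⟨ cong₂ (λ x y → (x ℤ.+ y) ℤ.* + suc d) (ℤP.pos-* a (suc q)) (ℤP.pos-* p (suc b)) ⟨
    + (a * suc q + p * suc b) ℤ.* + suc d
      ≡⟨ ℤP.pos-* (a * suc q + p * suc b) (suc d) ⟨
    + ((a * suc q + p * suc b) * suc d) ∎

+-/-≤⇒ℕ : ∀ x z {c d} p q .{{_ : NonZero q}} → 0ℚ ≤ x → toℚᵘ z U.≃ U.mkℚᵘ (+ c) d →
          x ℚ.+ (+ p) / q ≤ z → (↥ₙ x * q + p * ↧ₙ x) * suc d ℕ.≤ c * (↧ₙ x * q)
+-/-≤⇒ℕ x z p (suc q) x≥0 z≃ h = mkℚᵘ-+-≤⇒ℕ (↥ₙ x) (ℚ.denominator-1 x) p q _ _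
  (UP.≤-respʳ-≃ z≃ (UP.≤-respˡ-≃ x+y≃ (ℚP.toℚᵘ-mono-≤ h)))
  where
  x+y≃ : toℚᵘ (x ℚ.+ (+ p) / suc q) U.≃ U.mkℚᵘ (+ ↥ₙ x) (ℚ.denominator-1 x) U.+ U.mkℚᵘ (+ p) q
  x+y≃ = UP.≃-trans (ℚP.toℚᵘ-homo-+ x _)
           (UP.+-cong (UP.≃-reflexive (toℚᵘ-nonNeg x x≥0)) (toℚᵘ-/ (+ p) q))

/-<-/ : ∀ x b y d .{{_ : NonZero b}} .{{_ : NonZero d}} →
        (x + b) * d ℕ.≤ y * b → x div b ℕ.< y div d
/-<-/ x b y d h = begin
  suc q                ≡⟨ m*n/n≡m (suc q) d ⟨
  (suc q * d) div d    ≤⟨ /-monoˡ-≤ d (ℕP.*-cancelʳ-≤ (suc q * d) y b [1+q]db≤yb) ⟩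
  y div d              ∎
  where
  open ℕP.≤-Reasoning
  q = x div b
  [1+q]db≤yb : suc q * d * b ℕ.≤ y * b
  [1+q]db≤yb = begin
    suc q * d * b     ≡⟨ xy∙z≈xz∙y (suc q) d b ⟩
    suc q * b * d     ≤⟨ ℕP.*-monoˡ-≤ d (ℕP.+-monoʳ-≤ b (m/n*n≤m x b)) ⟩
    (b + x) * d       ≡⟨ cong (_* d) (ℕP.+-comm b x) ⟩
    (x + b) * d       ≤⟨ h ⟩
    y * b             ∎

mixedRadix-< : ∀ {a A x B} → a ℕ.< A → x ℕ.< B → a * B + x ℕ.< A * B
mixedRadix-< {a} {A} {x} {B} a<A x<B = begin-strict
  a * B + x   <⟨ ℕP.+-monoʳ-< (a * B) x<B ⟩
  a * B + B   ≡⟨ ℕP.+-comm (a * B) B ⟩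
  suc a * B   ≤⟨ ℕP.*-monoˡ-≤ B a<A ⟩
  A * B       ∎
  where open ℕP.≤-Reasoning

mixedRadix-quotient : ∀ a {x B} .{{_ : NonZero B}} → x ℕ.< B → (a * B + x) div B ≡ a
mixedRadix-quotient a {x} {B} x<B = begin
  (a * B + x) div B         ≡⟨ +-distrib-/-∣ˡ x (n∣m*n a) ⟩
  (a * B) div B + x div B   ≡⟨ cong₂ _+_ (m*n/n≡m a B) (m<n⇒m/n≡0 x<B) ⟩
  a + 0                     ≡⟨ ℕP.+-identityʳ a ⟩
  a                         ∎
  where open ≡-Reasoning

mixedRadix-injective : ∀ {a a' x x' B} → x ℕ.< B → x' ℕ.< B →
                       a * B + x ≡ a' * B + x' → a ≡ a' × x ≡ x'
mixedRadix-injective {a} {a'} {x} {x'} {B} x<B x'<B eq =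
  a≡a' , ℕP.+-cancelˡ-≡ (a' * B) x x' (subst (λ c → c * B + x ≡ a' * B + x') a≡a' eq)
  where
  instance
    B≢0 : NonZero B
    B≢0 = ℕ.>-nonZero (ℕP.≤-<-trans z≤n x<B)
  a≡a' : a ≡ a'
  a≡a' = trans (sym (mixedRadix-quotient a x<B)) (trans (cong (_div B) eq) (mixedRadix-quotient a' x'<B))

exponent-bound : ∀ {I J K} → I ℕ.< J → J ℕ.≤ K → 2 * (K ∸ J) + (J ∸ I) ℕ.≤ 2 * (K ∸ I) ∸ 1
exponent-bound {I} {J} {K} I<J J≤K
  with t , refl ← ℕP.m≤n⇒∃[o]m+o≡n I<J | u , refl ← ℕP.m≤n⇒∃[o]m+o≡n J≤K = begin
  2 * (suc I + t + u ∸ (suc I + t)) + (suc I + t ∸ I)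
    ≡⟨ cong₂ (λ x y → 2 * x + y) (ℕP.m+n∸m≡n (suc I + t) u)
                                  (trans (cong (_∸ I) (sym (ℕP.+-suc I t))) (ℕP.m+n∸m≡n I (suc t))) ⟩
  2 * u + suc t
    ≤⟨ ℕP.m≤m+n (2 * u + suc t) t ⟩
  2 * u + suc t + t
    ≡⟨ rearrange t u ⟨
  2 * suc (t + u) ∸ 1
    ≡⟨ cong (λ x → 2 * x ∸ 1) (ℕP.m+n∸m≡n I (suc (t + u))) ⟨
  2 * (I + suc (t + u) ∸ I) ∸ 1
    ≡⟨ cong (λ x → 2 * (x ∸ I) ∸ 1) (shift I t u) ⟩
  2 * (suc I + t + u ∸ I) ∸ 1 ∎
  where
  open ℕP.≤-Reasoning
  rearrange : ∀ t u → t + u + (suc (t + u) + 0) ≡ 2 * u + suc t + t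
  rearrange = solve-∀
  shift : ∀ I t u → I + suc (t + u) ≡ suc I + t + u
  shift = solve-∀

module _ {A : Set} where

  lookup-injective : ∀ {xs : List A} → Unique xs → ∀ {i j} → lookup xs i ≡ lookup xs j → i ≡ j
  lookup-injective {_ ∷ _} (_ ∷ _) {Fin.zero} {Fin.zero} _ = refl
  lookup-injective {_ ∷ _} (x∉ ∷ _) {Fin.zero} {Fin.suc j} eq = contradiction eq (All.lookup x∉ (∈-lookup j))
  lookup-injective {_ ∷ _} (x∉ ∷ _) {Fin.suc i} {Fin.zero} eq = contradiction (sym eq) (All.lookup x∉ (∈-lookup i))
  lookup-injective {_ ∷ _} (_ ∷ u) {Fin.suc i} {Fin.suc j} eq = cong Fin.suc (lookup-injective u eq)

  length-filter+length-filter-∁ : {P : A → Set} (P? : Decidable P) (xs : List A) →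
                                  length (filter P? xs) + length (filter (∁? P?) xs) ≡ length xs
  length-filter+length-filter-∁ P? [] = refl
  length-filter+length-filter-∁ P? (x ∷ xs) with P? x
  ... | yes _ = cong suc (length-filter+length-filter-∁ P? xs)
  ... | no _  = trans (ℕP.+-suc _ _) (cong suc (length-filter+length-filter-∁ P? xs))

length-cartesianProduct : {A B : Set} (xs : List A) (ys : List B) →
                          length (cartesianProduct xs ys) ≡ length xs * length ys
length-cartesianProduct [] ys = refl
length-cartesianProduct (x ∷ xs) ys = trans (ListP.length-++ (map (x ,_) ys))
  (cong₂ _+_ (ListP.length-map (x ,_) ys) (length-cartesianProduct xs ys))

Σ-Fin-≡ : ∀ {k} {f : Fin k → ℕ} {x y : Σ (Fin k) (λ j → Fin (f j))} →
          toℕ (proj₁ x) ≡ toℕ (proj₁ y) → toℕ (proj₂ x) ≡ toℕ (proj₂ y) → x ≡ y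
Σ-Fin-≡ {x = j , _} {_ , _} eq₁ eq₂ with refl ← FinP.toℕ-injective eq₁ =
  cong (j ,_) (FinP.toℕ-injective eq₂)

module OwnLayer (k n m : ℕ) .{{_ : NonZero m}} (m>C : m > n * k)
                (E : Fin (k ∸ 1) → Fin n → Fin n → Set) (σ : Schedule k n m)
                (feasible : Feasible E σ) (makespan : MakespanAtMost σ ((+ (n * k)) / 1))
                (i : Fin k) where

  open Schedule σ
  open Feasible feasible

  C I P L : ℕ
  C = n * k
  I = toℕ i
  P = m ^ I
  L = layerSize k m i

  instance
    P≢0 : NonZero P
    P≢0 = ℕP.m^n≢0 m I

  Pair : Set
  Pair = Fin n × Fin L

  job : Pair → Job k n m
  job p = i , proj₁ p , proj₂ p

  machine : Pair → Machine k m
  machine p = assign (job p)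

  layer num den : Pair → ℕ
  layer p = toℕ (proj₁ (machine p))
  num p = ↥ₙ start (job p)
  den p = ↧ₙ start (job p)

  Q : Pair → ℕ
  Q p = m ^ layer p

  instance
    Q≢0 : ∀ {p} → NonZero (Q p)
    Q≢0 {p} = ℕP.m^n≢0 m (layer p)

  finish≤⇒ℕ : ∀ p {z c d} → toℚᵘ z U.≃ U.mkℚᵘ (+ c) d → completion σ (job p) ≤ z →
              (num p * Q p + P * den p) * suc d ℕ.≤ c * (den p * Q p)
  finish≤⇒ℕ p z≃ = +-/-≤⇒ℕ (start (job p)) _ P (Q p) (startNonneg (job p)) z≃

  makespan≃ : toℚᵘ ((+ C) / 1) U.≃ U.mkℚᵘ (+ C) 0
  makespan≃ = toℚᵘ-/ (+ C) 0

  I≤layer : ∀ p → I ℕ.≤ layer p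
  I≤layer p = ℕP.≮⇒≥ λ layer<I → ℕP.<⇒≱ (begin-strict
      C * Q p   <⟨ ℕP.*-monoˡ-< (Q p) m>C ⟩
      m * Q p   ≤⟨ ℕP.^-monoʳ-≤ m layer<I ⟩
      P         ∎) P≤CQ
    where
    open ℕP.≤-Reasoning
    P≤CQ : P ℕ.≤ C * Q p
    P≤CQ = ℕP.*-cancelʳ-≤ P (C * Q p) (den p) (begin
      P * den p                            ≤⟨ ℕP.m≤n+m (P * den p) (num p * Q p) ⟩
      num p * Q p + P * den p              ≡⟨ ℕP.*-identityʳ _ ⟨
      (num p * Q p + P * den p) * 1        ≤⟨ finish≤⇒ℕ p makespan≃ (makespan (job p)) ⟩
      C * (den p * Q p)                    ≡⟨ x∙yz≈xz∙y C (den p) (Q p) ⟩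
      C * Q p * den p                      ∎)

  -- On its machine the job p runs for exactly 1 / D p time units.
  D : Pair → ℕ
  D p = m ^ (layer p ∸ I)

  Q≡P*D : ∀ p → Q p ≡ P * D p
  Q≡P*D p = trans (cong (m ^_) (sym (ℕP.m+[n∸m]≡n (I≤layer p)))) (ℕP.^-distribˡ-+-* m I (layer p ∸ I))

  finish≤⇒scaled : ∀ p {z c d} → toℚᵘ z U.≃ U.mkℚᵘ (+ c) d → completion σ (job p) ≤ z →
                   (num p * D p + den p) * suc d ℕ.≤ c * D p * den p
  finish≤⇒scaled p {c = c} {d} z≃ h = ℕP.*-cancelʳ-≤ _ _ P
    (subst₂ ℕ._≤_ (expandˡ (num p) (D p) (den p) P (suc d)) (expandʳ c (den p) P (D p))
      (subst (λ q → (num p * q + P * den p) * suc d ℕ.≤ c * (den p * q)) (Q≡P*D p) (finish≤⇒ℕ p z≃ h)))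
    where
    expandˡ : ∀ a D b P e → (a * (P * D) + P * b) * e ≡ (a * D + b) * e * P
    expandˡ = solve-∀
    expandʳ : ∀ c b P D → c * (b * (P * D)) ≡ c * D * b * P
    expandʳ = solve-∀

  slot : Pair → ℕ
  slot p = (num p * D p) div den p

  slot< : ∀ p → slot p ℕ.< C * D p
  slot< p = subst (slot p ℕ.<_) (n/1≡n (C * D p))
    (/-<-/ (num p * D p) (den p) (C * D p) 1 (finish≤⇒scaled p makespan≃ (makespan (job p))))

  slot-mono : ∀ p p' → layer p ≡ layer p' → completion σ (job p) ≤ start (job p') → slot p ℕ.< slot p'
  slot-mono p p' same h = subst (λ e → slot p ℕ.< (num p' * m ^ (e ∸ I)) div den p') same
    (/-<-/ (num p * D p) (den p) (num p' * D p) (den p')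
      (finish≤⇒scaled p (UP.≃-reflexive (toℚᵘ-nonNeg _ (startNonneg (job p')))) h))

  Other : Pair → Set
  Other p = ¬ proj₁ (machine p) ≡ i

  I<layer : ∀ p → Other p → I ℕ.< layer p
  I<layer p o = ℕP.≤∧≢⇒< (I≤layer p) (λ eq → o (FinP.toℕ-injective (sym eq)))

  -- Jobs on layer j > I are encoded by (j, machine index, slot) in mixed radix.
  B : ℕ
  B = C * m ^ (2 * (k ∸ 1 ∸ I) ∸ 1)

  inner code : Pair → ℕ
  inner p = toℕ (proj₂ (machine p)) * (C * D p) + slot p
  code p = layer p * B + inner p

  inner<B : ∀ p → Other p → inner p ℕ.< B
  inner<B p o = begin-strict
    inner p            <⟨ mixedRadix-< (FinP.toℕ<n (proj₂ (machine p))) (slot< p) ⟩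
    Lⱼ * (C * D p)     ≡⟨ x∙yz≈y∙xz Lⱼ C (D p) ⟩
    C * (Lⱼ * D p)     ≡⟨ cong (C *_) (ℕP.^-distribˡ-+-* m (2 * (k ∸ 1 ∸ layer p)) (layer p ∸ I)) ⟨
    C * m ^ (2 * (k ∸ 1 ∸ layer p) + (layer p ∸ I))
                       ≤⟨ ℕP.*-monoʳ-≤ C (ℕP.^-monoʳ-≤ m (exponent-bound (I<layer p o) layer≤)) ⟩
    B                  ∎
    where
    open ℕP.≤-Reasoning
    Lⱼ = layerSize k m (proj₁ (machine p))
    layer≤ : layer p ℕ.≤ k ∸ 1
    layer≤ = ℕP.<⇒≤pred (FinP.toℕ<n (proj₁ (machine p)))

  code<kB : ∀ p → Other p → code p ℕ.< k * B
  code<kB p o = mixedRadix-< (FinP.toℕ<n (proj₁ (machine p))) (inner<B p o)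

  code-injective : ∀ {p p'} → Other p → Other p' → code p ≡ code p' → p ≡ p'
  code-injective {p} {p'} o o' eq = decidable-stable (≡-dec FinP._≟_ FinP._≟_ p p') λ p≢p' →
    [ (λ h → ℕP.<-irrefl same-slot (slot-mono p p' same-layer h))
    , (λ h → ℕP.<-irrefl (sym same-slot) (slot-mono p' p (sym same-layer) h)) ]′
    (noOverlap (job p) (job p') (λ { refl → p≢p' refl }) (Σ-Fin-≡ same-layer same-index))
    where
    layers = mixedRadix-injective (inner<B p o) (inner<B p' o') eq
    same-layer : layer p ≡ layer p'
    same-layer = proj₁ layers
    same-width : C * D p' ≡ C * D p
    same-width = cong (λ e → C * m ^ (e ∸ I)) (sym same-layer)
    indices = mixedRadix-injective (slot< p) (subst (slot p' ℕ.<_) same-width (slot< p'))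
                (trans (proj₂ layers) (cong (λ w → toℕ (proj₂ (machine p')) * w + slot p') same-width))
    same-index : toℕ (proj₂ (machine p)) ≡ toℕ (proj₂ (machine p'))
    same-index = proj₁ indices
    same-slot : slot p ≡ slot p'
    same-slot = proj₂ indices

  m*B≡C*L : ∀ p → Other p → m * B ≡ C * L
  m*B≡C*L p o = begin
    m * (C * m ^ (e ∸ 1))   ≡⟨ x∙yz≈y∙xz m C (m ^ (e ∸ 1)) ⟩
    C * m ^ suc (e ∸ 1)     ≡⟨ cong (λ x → C * m ^ x) (ℕP.suc-pred e {{e≢0}}) ⟩
    C * L                   ∎
    where
    open ≡-Reasoning
    e = 2 * (k ∸ 1 ∸ I)
    e≢0 : NonZero e
    e≢0 = ℕ.>-nonZero (ℕP.*-monoʳ-< 2 (ℕP.m<n⇒0<n∸m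
            (ℕP.<-≤-trans (I<layer p o) (ℕP.<⇒≤pred (FinP.toℕ<n (proj₁ (machine p)))))))

  own? : Decidable (λ p → proj₁ (machine p) ≡ i)
  own? p = proj₁ (machine p) Fin.≟ i

  pairs others : List Pair
  pairs = cartesianProduct (allFin n) (allFin L)
  others = filter (∁? own?) pairs

  own+others≡size : onOwnLayer σ i + length others ≡ sizeL k n m i
  own+others≡size = trans (length-filter+length-filter-∁ own? pairs)
    (trans (length-cartesianProduct (allFin n) (allFin L))
           (cong₂ _*_ (ListP.length-tabulate {n = n} (λ x → x)) (ListP.length-tabulate {n = L} (λ x → x))))

  others-Other : All Other others
  others-Other = all-filter (∁? own?) pairs

  |others|≤k*B : length others ℕ.≤ k * B
  |others|≤k*B = FinP.injective⇒≤ {f = encode} λ eq →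
    lookup-injective unique (code-injective (other _) (other _)
      (trans (sym (FinP.toℕ-fromℕ< _)) (trans (cong toℕ eq) (FinP.toℕ-fromℕ< _))))
    where
    unique : Unique others
    unique = UniqueP.filter⁺ (∁? own?) (UniqueP.cartesianProduct⁺ (UniqueP.allFin⁺ n) (UniqueP.allFin⁺ L))
    other : ∀ t → Other (lookup others t)
    other t = All.lookup others-Other (∈-lookup t)
    encode : Fin (length others) → Fin (k * B)
    encode t = fromℕ< (code<kB (lookup others t) (other t))

  m*|others|≤k²*size : m * length others ℕ.≤ k * k * sizeL k n m i
  m*|others|≤k²*size = bound others others-Other |others|≤k*B
    where
    bound : (ps : List Pair) → All Other ps → length ps ℕ.≤ k * B → m * length ps ℕ.≤ k * k * (n * L)
    bound [] [] _ = subst (ℕ._≤ k * k * (n * L)) (sym (ℕP.*-zeroʳ m)) z≤n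
    bound ps@(p ∷ _) (o ∷ _) |ps|≤k*B = begin
      m * length ps     ≤⟨ ℕP.*-monoʳ-≤ m |ps|≤k*B ⟩
      m * (k * B)       ≡⟨ x∙yz≈y∙xz m k B ⟩
      k * (m * B)       ≡⟨ cong (k *_) (m*B≡C*L p o) ⟩
      k * (n * k * L)   ≡⟨ regroup k n L ⟩
      k * k * (n * L)   ∎
      where
      open ℕP.≤-Reasoning
      regroup : ∀ k n L → k * (n * k * L) ≡ k * k * (n * L)
      regroup = solve-∀

own≥[1-κ/m]*S : ∀ κ m own rest S .{{_ : NonZero m}} → own + rest ≡ S → m * rest ℕ.≤ κ * S →
                (1ℚ - (+ κ) / m) *ℚ ((+ S) / 1) ≤ (+ own) / 1
own≥[1-κ/m]*S κ (suc m) own rest _ refl h =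
  ℚP.toℚᵘ-cancel-≤ (UP.≤-respʳ-≃ (UP.≃-sym (toℚᵘ-/ (+ own) 0)) (UP.≤-respˡ-≃ (UP.≃-sym lhs≃) (U.*≤* ineq)))
  where
  lhs≃ : toℚᵘ ((1ℚ - (+ κ) / suc m) *ℚ ((+ (own + rest)) / 1)) U.≃
         (U.1ℚᵘ U.- U.mkℚᵘ (+ κ) m) U.* U.mkℚᵘ (+ (own + rest)) 0
  lhs≃ = UP.≃-trans (ℚP.toℚᵘ-homo-* (1ℚ - q) ((+ (own + rest)) / 1))
           (UP.*-cong (UP.≃-trans (ℚP.toℚᵘ-homo-+ 1ℚ (ℚ.- q))
                        (UP.+-cong UP.≃-refl (UP.≃-trans (ℚP.toℚᵘ-homo‿- q) (UP.-‿cong (toℚᵘ-/ (+ κ) m)))))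
                      (toℚᵘ-/ (+ (own + rest)) 0))
    where
    q = (+ κ) / suc m
  M = suc m
  expand : ∀ o r M κ → ((ℤ.1ℤ ℤ.* M ℤ.+ ℤ.- κ ℤ.* ℤ.1ℤ) ℤ.* (o ℤ.+ r)) ℤ.* ℤ.1ℤ
                       ≡ o ℤ.* M ℤ.+ (M ℤ.* r ℤ.- κ ℤ.* (o ℤ.+ r))
  expand = ℤSolver.solve-∀
  ineq : ((ℤ.1ℤ ℤ.* + M ℤ.+ ℤ.- + κ ℤ.* ℤ.1ℤ) ℤ.* + (own + rest)) ℤ.* ℤ.1ℤ
         ℤ.≤ + own ℤ.* + ((1 * M) * 1)
  ineq = begin
    ((ℤ.1ℤ ℤ.* + M ℤ.+ ℤ.- + κ ℤ.* ℤ.1ℤ) ℤ.* + (own + rest)) ℤ.* ℤ.1ℤ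
      ≡⟨ expand (+ own) (+ rest) (+ M) (+ κ) ⟩
    + own ℤ.* + M ℤ.+ (+ M ℤ.* + rest ℤ.- + κ ℤ.* + (own + rest))
      ≡⟨ cong₂ (λ x y → + own ℤ.* + M ℤ.+ (x ℤ.- y)) (ℤP.pos-* M rest) (ℤP.pos-* κ (own + rest)) ⟨
    + own ℤ.* + M ℤ.+ (+ (M * rest) ℤ.- + (κ * (own + rest)))
      ≤⟨ ℤP.+-monoʳ-≤ (+ own ℤ.* + M) (ℤP.i≤j⇒i-j≤0 (ℤ.+≤+ h)) ⟩
    + own ℤ.* + M ℤ.+ ℤ.0ℤ
      ≡⟨ ℤP.+-identityʳ _ ⟩
    + own ℤ.* + M
      ≡⟨ cong (λ x → + own ℤ.* + x) (trans (ℕP.*-identityʳ (1 * M)) (ℕP.*-identityˡ M)) ⟨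
    + own ℤ.* + ((1 * M) * 1) ∎
    where open ℤP.≤-Reasoning

lemma1 : (k n m : ℕ) → k > 1 → m > n * k → .{{_ : NonZero m}} →
         (E : Fin (k ∸ 1) → Fin n → Fin n → Set) →
         (σ : Schedule k n m) → Feasible E σ →
         MakespanAtMost σ ((+ (n * k)) / 1) →
         (i : Fin k) →
         (1ℚ - (+ (k * k)) / m) *ℚ ((+ sizeL k n m i) / 1)
           ≤ (+ onOwnLayer σ i) / 1
lemma1 k n m _ m>C E σ feasible makespan i =
  own≥[1-κ/m]*S (k * k) m (onOwnLayer σ i) (length others) (sizeL k n m i)
    own+others≡size m*|others|≤k²*size
  where open OwnLayer k n m m>C E σ feasible makespan i
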